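{- For every tree form formula $\alpha$ and every valuation $P : X \to [0,1]$, $$P(\alpha) = \sum_{t \in \mathrm{Top}(\alpha)} \prod_{a \in t} P(a),$$ where the product runs over the tokens of the path $t$ (with multiplicity) and $P(\overline{x}) = 1 - P(x)$.
   Context: Aleatoric calculus formulae over a set $X$ of random variables are generated by $\alpha ::= x \mid \top \mid \bot \mid (\alpha\,?\,\alpha:\alpha)$ with $x \in X$. A valuation $P : X \to [0,1]$ extends to all formulae by $P(\top)=1$, $P(\bot)=0$, $P(\alpha\,?\,\beta:\gamma) = P(\alpha)P(\beta) + (1-P(\alpha))P(\gamma)$. Tree form formulae are generated by $\varphi ::= \top \mid \bot \mid (x\,?\,\varphi:\varphi)$ with $x\in X$. A path is a finite sequence of tokens from $\{x, \overline{x} : x \in X\}$. For tree form formulae define $\mathrm{Top}(\top)=\mathrm{Bot}(\bot)=\{\langle\rangle\}$, $\mathrm{Top}(\bot)=\mathrm{Bot}(\top)=\emptyset$, $\mathrm{Top}(x\,?\,\alpha:\beta) = \{\langle x\rangle ^\frown a : a \in \mathrm{Top}(\alpha)\} \cup \{\langle \overline{x}\rangle ^\frown b : b \in \mathrm{Top}(\beta)\}$, and analogously $\mathrm{Bot}(x\,?\,\alpha:\beta) = \{\langle x\rangle ^\frown a : a \in \mathrm{Bot}(\alpha)\} \cup \{\langle \overline{x}\rangle ^\frown b : b \in \mathrm{Bot}(\beta)\}$, where $^\frown$ is concatenation. -}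

module Defs where

open import Level using (Level)
open import Data.List using (List; []; _∷_; map; foldr)
open import Algebra.Bundles using (CommutativeRing)

data Form (X : Set) : Set where
  var : X → Form X
  top : Form X
  bot : Form X
  ite : Form X → Form X → Form X → Form X

data IsTree {X : Set} : Form X → Set where
  top  : IsTree top
  bot  : IsTree bot
  ite  : ∀ x {φ ψ} → IsTree φ → IsTree ψ → IsTree (ite (var x) φ ψ)

data Token (X : Set) : Set where
  pos : X → Token X
  neg : X → Token X

Path : Set → Set
Path X = List (Token X)

-- Top(α) for tree form α (as a list of paths; for a tree these are
-- pairwise distinct, so the list represents the set Top(α))
Top : {X : Set} (α : Form X) → IsTree α → List (Path X)
Top .top top = [] ∷ []
Top .bot bot = []
Top .(ite (var x) _ _) (ite x tφ tψ) =
  Data.List._++_ (map (pos x ∷_) (Top _ tφ)) (map (neg x ∷_) (Top _ tψ))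

Bot : {X : Set} (α : Form X) → IsTree α → List (Path X)
Bot .top top = []
Bot .bot bot = [] ∷ []
Bot .(ite (var x) _ _) (ite x tφ tψ) =
  Data.List._++_ (map (pos x ∷_) (Bot _ tφ)) (map (neg x ∷_) (Bot _ tψ))

module _ {c ℓ : Level} (R : CommutativeRing c ℓ) where
  open CommutativeRing R

  eval : {X : Set} → (X → Carrier) → Form X → Carrier
  eval P (var x) = P x
  eval P top = 1#
  eval P bot = 0#
  eval P (ite α β γ) = eval P α * eval P β + (1# - eval P α) * eval P γ

  tokVal : {X : Set} → (X → Carrier) → Token X → Carrier
  tokVal P (pos x) = P x
  tokVal P (neg x) = 1# - P x

  pathProd : {X : Set} → (X → Carrier) → Path X → Carrier
  pathProd P t = foldr _*_ 1# (map (tokVal P) t)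

  sumR : List Carrier → Carrier
  sumR = foldr _+_ 0#

module Submission where

-- Prefixing a token multiplies every path product by the token's value,
-- so the sum splits as P x · Σ_φ + (1 - P x) · Σ_ψ, which is exactly the evaluation clause for ite.

open import Defs
open import Level using (Level)
open import Data.List using (List; []; _∷_; map; _++_)
open import Data.List.Properties using (map-++; map-∘)
open import Algebra.Bundles using (CommutativeRing)
import Relation.Binary.PropositionalEquality as ≡
import Relation.Binary.Reasoning.Setoid as SetoidReasoning

module _ {c ℓ : Level} (R : CommutativeRing c ℓ) where
  open CommutativeRing R
  open SetoidReasoning setoid

  sumR-++ : (xs ys : List Carrier) → sumR R (xs ++ ys) ≈ sumR R xs + sumR R ys
  sumR-++ []       ys = sym (+-identityˡ _)
  sumR-++ (x ∷ xs) ys = begin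
    x + sumR R (xs ++ ys)          ≈⟨ +-congˡ (sumR-++ xs ys) ⟩
    x + (sumR R xs + sumR R ys)    ≈⟨ sym (+-assoc _ _ _) ⟩
    (x + sumR R xs) + sumR R ys    ∎

  sumR-*-distribˡ : (a : Carrier) (xs : List Carrier) → sumR R (map (a *_) xs) ≈ a * sumR R xs
  sumR-*-distribˡ a []       = sym (zeroʳ _)
  sumR-*-distribˡ a (x ∷ xs) = begin
    a * x + sumR R (map (a *_) xs) ≈⟨ +-congˡ (sumR-*-distribˡ a xs) ⟩
    a * x + a * sumR R xs          ≈⟨ sym (distribˡ _ _ _) ⟩
    a * (x + sumR R xs)            ∎

  module _ {X : Set} (P : X → Carrier) where

    sumPathProd : List (Path X) → Carrier
    sumPathProd ts = sumR R (map (pathProd R P) ts)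

    sumPathProd-++ : (ts us : List (Path X)) → sumPathProd (ts ++ us) ≈ sumPathProd ts + sumPathProd us
    sumPathProd-++ ts us = begin
      sumR R (map (pathProd R P) (ts ++ us))                     ≡⟨ ≡.cong (sumR R) (map-++ (pathProd R P) ts us) ⟩
      sumR R (map (pathProd R P) ts ++ map (pathProd R P) us)    ≈⟨ sumR-++ (map (pathProd R P) ts) (map (pathProd R P) us) ⟩
      sumPathProd ts + sumPathProd us                            ∎

    sumPathProd-prefix : (a : Token X) (ts : List (Path X)) →
                         sumPathProd (map (a ∷_) ts) ≈ tokVal R P a * sumPathProd ts
    sumPathProd-prefix a ts = begin
      sumR R (map (pathProd R P) (map (a ∷_) ts))                ≡⟨ ≡.cong (sumR R) prefix-commutes ⟩
      sumR R (map (tokVal R P a *_) (map (pathProd R P) ts))     ≈⟨ sumR-*-distribˡ (tokVal R P a) (map (pathProd R P) ts) ⟩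
      tokVal R P a * sumPathProd ts                              ∎
      where
      -- both sides are map of the same composite, since pathProd (a ∷ t) unfolds to tokVal a * pathProd t
      prefix-commutes : map (pathProd R P) (map (a ∷_) ts) ≡.≡ map (tokVal R P a *_) (map (pathProd R P) ts)
      prefix-commutes = ≡.trans (≡.sym (map-∘ {g = pathProd R P} ts)) (map-∘ ts)

    eval≈sumPathProd-Top : (α : Form X) (t : IsTree α) → eval R P α ≈ sumPathProd (Top α t)
    eval≈sumPathProd-Top .top top = sym (+-identityʳ _)
    eval≈sumPathProd-Top .bot bot = refl
    eval≈sumPathProd-Top .(ite (var x) _ _) (ite x {φ} {ψ} tφ tψ) = begin
      P x * eval R P φ + (1# - P x) * eval R P ψ
        ≈⟨ +-cong (*-congˡ (eval≈sumPathProd-Top φ tφ)) (*-congˡ (eval≈sumPathProd-Top ψ tψ)) ⟩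
      P x * sumPathProd (Top φ tφ) + (1# - P x) * sumPathProd (Top ψ tψ)
        ≈⟨ sym (+-cong (sumPathProd-prefix (pos x) (Top φ tφ)) (sumPathProd-prefix (neg x) (Top ψ tψ))) ⟩
      sumPathProd (map (pos x ∷_) (Top φ tφ)) + sumPathProd (map (neg x ∷_) (Top ψ tψ))
        ≈⟨ sym (sumPathProd-++ (map (pos x ∷_) (Top φ tφ)) (map (neg x ∷_) (Top ψ tψ))) ⟩
      sumPathProd (map (pos x ∷_) (Top φ tφ) ++ map (neg x ∷_) (Top ψ tψ)) ∎

lemma6 : {c ℓ : Level} (R : CommutativeRing c ℓ) {X : Set} (α : Form X) (t : IsTree α) (P : X → CommutativeRing.Carrier R) → CommutativeRing._≈_ R (eval R P α) (sumR R (map (pathProd R P) (Top α t)))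
lemma6 R α t P = eval≈sumPathProd-Top R P α t
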